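{- Let $G$ be a finite group with $d(G)=3$ and a generating set $\{a,b,c\}$ such that $|a|,|b|,|c|,|ba^{ -1}|,|cb^{ -1}|>2$, $[a,b]\ne 1$ and $[b,c]=1$. Then $G$ admits an ORR.
   Context: $d(G)$ is the minimum cardinality of a generating set of $G$; $|g|$ is the order; $[x,y]$ the commutator. The Cayley digraph $\mathrm{Cay}(G,S)$ has vertex set $G$ and arcs $(x,y)$ with $yx^{ -1}\in S$. $G$ admits an ORR if there is $S\subseteq G$ with $S\cap S^{ -1}=\emptyset$ and the full automorphism group of $\mathrm{Cay}(G,S)$ equal to the right regular representation of $G$. -}

module Defs where

open import Level using (0ℓ)
open import Data.Nat using (ℕ; zero; suc; _<_; _≤_)
open import Data.Fin using (Fin)
open import Data.Fin.Subset using (Subset; _∈_; _∉_)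
open import Data.Fin.Permutation using (Permutation′; _⟨$⟩ʳ_)
open import Data.List using (List; length)
open import Data.List.Membership.Propositional using () renaming (_∈_ to _∈ₗ_)
open import Data.Product using (Σ; ∃; _×_; _,_)
open import Relation.Binary.PropositionalEquality using (_≡_; _≢_)
open import Relation.Nullary using (¬_)
open import Algebra.Structures using (IsGroup)

-- A finite group of order n, presented (up to isomorphism) on the carrier Fin n,
-- with propositional equality as the group equality.
record FinGroup (n : ℕ) : Set where
  field
    _∙_     : Fin n → Fin n → Fin n
    ε       : Fin n
    _⁻¹     : Fin n → Fin n
    isGroup : IsGroup _≡_ _∙_ ε _⁻¹
  infixl 7 _∙_
  infix 8 _⁻¹

module _ {n : ℕ} (G : FinGroup n) where
  open FinGroup G

  pow : Fin n → ℕ → Fin n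
  pow g zero    = ε
  pow g (suc k) = pow g k ∙ g

  HasOrder : Fin n → ℕ → Set
  HasOrder g k = (1 ≤ k) × (pow g k ≡ ε) × (∀ j → 1 ≤ j → j < k → pow g j ≢ ε)

  OrderGt2 : Fin n → Set
  OrderGt2 g = ∃ λ k → HasOrder g k × (2 < k)

  comm : Fin n → Fin n → Fin n
  comm x y = x ⁻¹ ∙ y ⁻¹ ∙ x ∙ y

  data InSpan (S : List (Fin n)) : Fin n → Set where
    gen : ∀ {x} → x ∈ₗ S → InSpan S x
    one : InSpan S ε
    mul : ∀ {x y} → InSpan S x → InSpan S y → InSpan S (x ∙ y)
    inv : ∀ {x} → InSpan S x → InSpan S (x ⁻¹)

  Generates : List (Fin n) → Set
  Generates S = ∀ x → InSpan S x

  RankIs : ℕ → Set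
  RankIs k = (∃ λ S → Generates S × length S ≡ k)
           × (∀ S → Generates S → k ≤ length S)

  Arc : Subset n → Fin n → Fin n → Set
  Arc S x y = (y ∙ x ⁻¹) ∈ S

  IsCayAut : Subset n → Permutation′ n → Set
  IsCayAut S φ = ∀ x y → (Arc S x y → Arc S (φ ⟨$⟩ʳ x) (φ ⟨$⟩ʳ y))
                       × (Arc S (φ ⟨$⟩ʳ x) (φ ⟨$⟩ʳ y) → Arc S x y)

  IsRightTranslation : Permutation′ n → Set
  IsRightTranslation φ = ∃ λ g → ∀ x → φ ⟨$⟩ʳ x ≡ x ∙ g

  -- S is an ORR connection set: S ∩ S⁻¹ = ∅ and Aut(Cay(G,S)) = R(G)
  IsORR : Subset n → Set
  IsORR S = (∀ x → x ∈ S → x ⁻¹ ∉ S)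
          × (∀ φ → IsCayAut S φ → IsRightTranslation φ)
          × (∀ φ → IsRightTranslation φ → IsCayAut S φ)

  AdmitsORR : Set
  AdmitsORR = ∃ λ (S : Subset n) → IsORR S

module Submission where

-- Right translations are automorphisms of any Cayley digraph.  Conversely,
-- for an automorphism φ and a vertex z, u ↦ φ(uz) φ(z)⁻¹ is injective,
-- preserves arcs and fixes 1; if every such map fixes the generators a, b, c,
-- then φ(sz) = s φ(z) for s = a, b, c, and φ is right multiplication by
-- φ(1) (module Cayley).  Such a map sends S = N⁺(1) into S preserving the
-- arcs inside S.  Every relation t s⁻¹ = r or s⁻¹ = r among elements of S,
-- other than those giving the arcs a → b, b → c, y → c, x → a, b → x, is
-- refuted: together with [b,c] = 1 it rewrites in the free group to an
-- equation contradicting the hypotheses.  These 125 rewritings are stored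
-- as certificates and checked by evaluation.  In the surviving arc pattern
-- only c has two in-neighbours and y has none, which pins a, b and c.

open import Defs
open import Level using (0ℓ)
open import Algebra.Bundles using (Group)
open import Algebra.Structures using (IsGroup)
import Algebra.Properties.Group as GroupProperties
open import Data.Bool using (Bool; true; false; not; T; _∧_)
open import Data.Bool.ListAction using (all)
import Data.Bool.Properties as Bool
open import Data.Bool.Properties using (T-∧)
open import Data.Empty using (⊥; ⊥-elim)
open import Data.Fin using (Fin; zero; suc)
import Data.Fin.Properties as Fin
open import Data.Fin.Permutation using (_⟨$⟩ʳ_; _⟨$⟩ˡ_) renaming (inverseˡ to inverseˡ-perm)
open import Data.Fin.Subset using (Subset; _∈_; _∉_)
open import Data.List using (List; []; _∷_; _++_; take; drop; foldr; length; map)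
open import Data.List.Membership.DecPropositional (Fin._≟_ {3}) using (_∈?_)
open import Data.List.Membership.Propositional using () renaming (_∈_ to _∈ₗ_)
open import Data.List.Membership.Propositional.Properties using (∈-map⁺; ∈-map⁻)
open import Data.List.Properties using (take++drop≡id) renaming (≡-dec to List-≡-dec)
open import Data.List.Relation.Unary.All using (All; []; _∷_)
import Data.List.Relation.Unary.All as All
open import Data.List.Relation.Unary.All.Properties using (all⁺)
open import Data.List.Relation.Unary.Any using (here; there)
open import Data.Nat using (ℕ; zero; suc; _≤_; s≤s; z≤n)
open import Data.Product using (∃; _×_; _,_; proj₁; proj₂)
open import Data.Product.Properties using () renaming (≡-dec to Σ-≡-dec)
open import Data.Unit using (tt)
import Data.Vec as Vec
open import Data.Vec.Properties using ([]=⇒lookup; lookup⇒[]=; lookup∘tabulate)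
open import Function.Bundles using (Equivalence)
open import Relation.Binary.Definitions using (DecidableEquality)
open import Relation.Binary.PropositionalEquality
open import Relation.Nullary using (¬_; Dec; yes; no; does; isYes)
open import Relation.Nullary.Decidable using (toWitness; dec-true)

-- A word is a list of letters (i , false) = xᵢ and (i , true) = xᵢ⁻¹.  A
-- derivation repeatedly inserts a cyclic rotation of a relator (or of its
-- formal inverse) at some position and freely reduces the result.  It is a
-- purely syntactic object, so whether a given list of steps leads from one
-- word to another is decided by evaluation; the semantics below shows that
-- such a derivation proves an equation in every group satisfying the relators.

Letter : ℕ → Set
Letter k = Fin k × Bool

Word : ℕ → Set
Word k = List (Letter k)

_≟ˡ_ : ∀ {k} → DecidableEquality (Letter k)
_≟ˡ_ = Σ-≡-dec Fin._≟_ Bool._≟_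

_≟ʷ_ : ∀ {k} → DecidableEquality (Word k)
_≟ʷ_ = List-≡-dec _≟ˡ_

invLetter : ∀ {k} → Letter k → Letter k
invLetter (i , s) = i , not s

invWord : ∀ {k} → Word k → Word k
invWord []      = []
invWord (l ∷ w) = invWord w ++ invLetter l ∷ []

commutatorWord : ∀ {k} → Fin k → Fin k → Word k
commutatorWord i j = (i , true) ∷ (j , true) ∷ (i , false) ∷ (j , false) ∷ []

push : ∀ {k} → Letter k → Word k → Word k
push l []      = l ∷ []
push l (m ∷ w) with l ≟ˡ invLetter m
... | yes _ = w
... | no  _ = l ∷ m ∷ w

reduce : ∀ {k} → Word k → Word k
reduce = foldr push []

rotate : ∀ {k} → ℕ → Word k → Word k
rotate j w = drop j w ++ take j w

data Orientation : Set where
  as-is inverted : Orientation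

orient : ∀ {k} → Orientation → Word k → Word k
orient as-is    w = w
orient inverted w = invWord w

record Step : Set where
  constructor ins
  field
    position relator : ℕ
    orientation      : Orientation
    rotation         : ℕ

-- relator number i of a list (the empty word when out of range)
relatorAt : ∀ {k} → List (Word k) → ℕ → Word k
relatorAt []       _       = []
relatorAt (r ∷ rs) zero    = r
relatorAt (r ∷ rs) (suc i) = relatorAt rs i

applyStep : ∀ {k} → List (Word k) → Step → Word k → Word k
applyStep rs (ins p i o j) w =
  reduce (take p w ++ rotate j (orient o (relatorAt rs i)) ++ drop p w)

runSteps : ∀ {k} → List (Word k) → List Step → Word k → Word k
runSteps rs []       w = w
runSteps rs (s ∷ ss) w = runSteps rs ss (applyStep rs s w)

Derives : ∀ {k} → List (Word k) → List Step → Word k → Word k → Bool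
Derives rs ss u v = isYes (runSteps rs ss (reduce u) ≟ʷ reduce v)

module GroupFacts {n : ℕ} (G : FinGroup n) where
  open FinGroup G
  open IsGroup isGroup public using (assoc; identityˡ; identityʳ; inverseˡ; inverseʳ)

  asGroup : Group 0ℓ 0ℓ
  asGroup = record { isGroup = isGroup }

  open GroupProperties asGroup public
    using (⁻¹-involutive; ⁻¹-anti-homo-∙; ε⁻¹≈ε; inverseʳ-unique; ∙-cancelʳ; //-rightDividesˡ)

  swap-ε : ∀ x y → x ∙ y ≡ ε → y ∙ x ≡ ε
  swap-ε x y xy≡ε = begin
    y ∙ x      ≡⟨ cong (_∙ x) (inverseʳ-unique x y xy≡ε) ⟩
    x ⁻¹ ∙ x   ≡⟨ inverseˡ x ⟩
    ε          ∎
    where open ≡-Reasoning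

  -- the arc relation of a Cayley digraph is invariant under right translation
  right-invariant : ∀ p q r → (p ∙ q) ∙ (r ∙ q) ⁻¹ ≡ p ∙ r ⁻¹
  right-invariant p q r = begin
    (p ∙ q) ∙ (r ∙ q) ⁻¹      ≡⟨ cong ((p ∙ q) ∙_) (⁻¹-anti-homo-∙ r q) ⟩
    (p ∙ q) ∙ (q ⁻¹ ∙ r ⁻¹)   ≡⟨ assoc p q _ ⟩
    p ∙ (q ∙ (q ⁻¹ ∙ r ⁻¹))   ≡⟨ cong (p ∙_) (sym (assoc q (q ⁻¹) _)) ⟩
    p ∙ ((q ∙ q ⁻¹) ∙ r ⁻¹)   ≡⟨ cong (λ u → p ∙ (u ∙ r ⁻¹)) (inverseʳ q) ⟩
    p ∙ (ε ∙ r ⁻¹)            ≡⟨ cong (p ∙_) (identityˡ _) ⟩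
    p ∙ r ⁻¹                  ∎
    where open ≡-Reasoning

  order>2⇒≢ε : ∀ {g} → OrderGt2 G g → g ≢ ε
  order>2⇒≢ε (k , (_ , _ , minimal) , s≤s (s≤s _)) g≡ε =
    minimal 1 (s≤s z≤n) (s≤s (s≤s z≤n)) (trans (identityˡ _) g≡ε)

  order>2⇒square≢ε : ∀ {g} → OrderGt2 G g → g ∙ g ≢ ε
  order>2⇒square≢ε (k , (_ , _ , minimal) , 2<k) g²≡ε =
    minimal 2 (s≤s z≤n) 2<k (trans (cong (_∙ _) (identityˡ _)) g²≡ε)

  order⇒finite : ∀ {g} → OrderGt2 G g → ∃ λ m → pow G g (suc m) ≡ ε
  order⇒finite (suc m , (_ , gᵏ≡ε , _) , _) = m , gᵏ≡ε

module Evaluation {n : ℕ} (G : FinGroup n) {k : ℕ} (ρ : Fin k → Fin n) where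
  open FinGroup G
  open GroupFacts G

  evLetter : Letter k → Fin n
  evLetter (i , false) = ρ i
  evLetter (i , true)  = ρ i ⁻¹

  ev : Word k → Fin n
  ev []      = ε
  ev (l ∷ w) = evLetter l ∙ ev w

  ev-++ : ∀ u v → ev (u ++ v) ≡ ev u ∙ ev v
  ev-++ []      v = sym (identityˡ _)
  ev-++ (l ∷ u) v = trans (cong (evLetter l ∙_) (ev-++ u v)) (sym (assoc _ _ _))

  evLetter-inv : ∀ l → evLetter (invLetter l) ≡ evLetter l ⁻¹
  evLetter-inv (i , false) = refl
  evLetter-inv (i , true)  = sym (⁻¹-involutive _)

  ev-invWord : ∀ w → ev (invWord w) ≡ ev w ⁻¹
  ev-invWord []      = sym ε⁻¹≈ε
  ev-invWord (l ∷ w) = begin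
    ev (invWord w ++ invLetter l ∷ [])       ≡⟨ ev-++ (invWord w) _ ⟩
    ev (invWord w) ∙ (evLetter (invLetter l) ∙ ε)
                                             ≡⟨ cong₂ _∙_ (ev-invWord w) (trans (identityʳ _) (evLetter-inv l)) ⟩
    ev w ⁻¹ ∙ evLetter l ⁻¹                  ≡⟨ sym (⁻¹-anti-homo-∙ _ _) ⟩
    (evLetter l ∙ ev w) ⁻¹                   ∎
    where open ≡-Reasoning

  ev-commutatorWord : ∀ i j → ev (commutatorWord i j) ≡ comm G (ρ i) (ρ j)
  ev-commutatorWord i j = begin
    ρ i ⁻¹ ∙ (ρ j ⁻¹ ∙ (ρ i ∙ (ρ j ∙ ε)))   ≡⟨ cong (λ u → ρ i ⁻¹ ∙ (ρ j ⁻¹ ∙ (ρ i ∙ u))) (identityʳ (ρ j)) ⟩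
    ρ i ⁻¹ ∙ (ρ j ⁻¹ ∙ (ρ i ∙ ρ j))         ≡⟨ sym (assoc _ _ _) ⟩
    ρ i ⁻¹ ∙ ρ j ⁻¹ ∙ (ρ i ∙ ρ j)           ≡⟨ sym (assoc _ _ _) ⟩
    ρ i ⁻¹ ∙ ρ j ⁻¹ ∙ ρ i ∙ ρ j             ∎
    where open ≡-Reasoning

  word-in-span : ∀ {I} w → All (λ l → proj₁ l ∈ₗ I) w → InSpan G (map ρ I) (ev w)
  word-in-span []              []           = one
  word-in-span ((i , false) ∷ w) (i∈I ∷ w⊆I) = mul (gen (∈-map⁺ ρ i∈I)) (word-in-span w w⊆I)
  word-in-span ((i , true)  ∷ w) (i∈I ∷ w⊆I) = mul (inv (gen (∈-map⁺ ρ i∈I))) (word-in-span w w⊆I)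

  push-sound : ∀ l w → ev (push l w) ≡ evLetter l ∙ ev w
  push-sound l []      = refl
  push-sound l (m ∷ w) with l ≟ˡ invLetter m
  ... | no  _    = refl
  ... | yes refl = begin
    ev w                                          ≡⟨ sym (identityˡ _) ⟩
    ε ∙ ev w                                      ≡⟨ cong (_∙ ev w) (sym (inverseˡ (evLetter m))) ⟩
    evLetter m ⁻¹ ∙ evLetter m ∙ ev w             ≡⟨ cong (λ u → u ∙ evLetter m ∙ ev w) (sym (evLetter-inv m)) ⟩
    evLetter (invLetter m) ∙ evLetter m ∙ ev w    ≡⟨ assoc _ _ _ ⟩
    evLetter (invLetter m) ∙ (evLetter m ∙ ev w)  ∎
    where open ≡-Reasoning

  reduce-sound : ∀ w → ev (reduce w) ≡ ev w
  reduce-sound []      = refl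
  reduce-sound (l ∷ w) = trans (push-sound l (reduce w)) (cong (evLetter l ∙_) (reduce-sound w))

  rotate-relator : ∀ j w → ev w ≡ ε → ev (rotate j w) ≡ ε
  rotate-relator j w w≡ε = trans (ev-++ (drop j w) (take j w)) (swap-ε _ _ (begin
    ev (take j w) ∙ ev (drop j w)   ≡⟨ sym (ev-++ (take j w) (drop j w)) ⟩
    ev (take j w ++ drop j w)       ≡⟨ cong ev (take++drop≡id j w) ⟩
    ev w                            ≡⟨ w≡ε ⟩
    ε                               ∎))
    where open ≡-Reasoning

  orient-relator : ∀ o w → ev w ≡ ε → ev (orient o w) ≡ ε
  orient-relator as-is    w w≡ε = w≡ε
  orient-relator inverted w w≡ε = trans (ev-invWord w) (trans (cong _⁻¹ w≡ε) ε⁻¹≈ε)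

  Relators : List (Word k) → Set
  Relators rs = All (λ r → ev r ≡ ε) rs

  relatorAt-sound : ∀ {rs} → Relators rs → ∀ i → ev (relatorAt rs i) ≡ ε
  relatorAt-sound []         _       = refl
  relatorAt-sound (r≡ε ∷ _)  zero    = r≡ε
  relatorAt-sound (_ ∷ rs≡ε) (suc i) = relatorAt-sound rs≡ε i

  insert-relator : ∀ u r v → ev r ≡ ε → ev (u ++ r ++ v) ≡ ev (u ++ v)
  insert-relator u r v r≡ε = begin
    ev (u ++ r ++ v)        ≡⟨ ev-++ u (r ++ v) ⟩
    ev u ∙ ev (r ++ v)      ≡⟨ cong (ev u ∙_) (ev-++ r v) ⟩
    ev u ∙ (ev r ∙ ev v)    ≡⟨ cong (λ x → ev u ∙ (x ∙ ev v)) r≡ε ⟩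
    ev u ∙ (ε ∙ ev v)       ≡⟨ cong (ev u ∙_) (identityˡ _) ⟩
    ev u ∙ ev v             ≡⟨ sym (ev-++ u v) ⟩
    ev (u ++ v)             ∎
    where open ≡-Reasoning

  runSteps-sound : ∀ {rs} → Relators rs → ∀ ss w → ev (runSteps rs ss w) ≡ ev w
  runSteps-sound         rs≡ε []                     w = refl
  runSteps-sound {rs} rs≡ε (s@(ins p i o j) ∷ ss) w = begin
    ev (runSteps rs ss (applyStep rs s w)) ≡⟨ runSteps-sound rs≡ε ss _ ⟩
    ev (applyStep rs s w)                  ≡⟨ reduce-sound (take p w ++ inserted ++ drop p w) ⟩
    ev (take p w ++ inserted ++ drop p w)  ≡⟨ insert-relator (take p w) inserted (drop p w) inserted≡ε ⟩
    ev (take p w ++ drop p w)              ≡⟨ cong ev (take++drop≡id p w) ⟩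
    ev w                                   ∎
    where
      open ≡-Reasoning
      inserted = rotate j (orient o (relatorAt rs i))
      inserted≡ε : ev inserted ≡ ε
      inserted≡ε = rotate-relator j _ (orient-relator o _ (relatorAt-sound rs≡ε i))

  derives-sound : ∀ {rs} → Relators rs → ∀ ss u v → T (Derives rs ss u v) → ev u ≡ ev v
  derives-sound {rs} rs≡ε ss u v ok = begin
    ev u                            ≡⟨ sym (reduce-sound u) ⟩
    ev (reduce u)                   ≡⟨ sym (runSteps-sound rs≡ε ss (reduce u)) ⟩
    ev (runSteps rs ss (reduce u))  ≡⟨ cong ev (toWitness {a? = runSteps rs ss (reduce u) ≟ʷ reduce v} ok) ⟩
    ev (reduce v)                   ≡⟨ reduce-sound v ⟩
    ev v                            ∎
    where open ≡-Reasoning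

module Spans {n : ℕ} (G : FinGroup n) where
  open FinGroup G

  span-mono : ∀ {L L'} → (∀ {z} → z ∈ₗ L → InSpan G L' z) → ∀ {z} → InSpan G L z → InSpan G L' z
  span-mono L⊆ (gen z∈L) = L⊆ z∈L
  span-mono L⊆ one       = one
  span-mono L⊆ (mul p q) = mul (span-mono L⊆ p) (span-mono L⊆ q)
  span-mono L⊆ (inv p)   = inv (span-mono L⊆ p)

  rank-bound : ∀ {d L L'} → RankIs G d → Generates G L →
               (∀ {z} → z ∈ₗ L → InSpan G L' z) → d ≤ length L'
  rank-bound (_ , minimal) generates L⊆ = minimal _ (λ z → span-mono L⊆ (generates z))

  not-two-generated : ∀ {x₁ x₂ x₃ p q} → RankIs G 3 → Generates G (x₁ ∷ x₂ ∷ x₃ ∷ []) →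
                      InSpan G (p ∷ q ∷ []) x₁ → InSpan G (p ∷ q ∷ []) x₂ → InSpan G (p ∷ q ∷ []) x₃ → ⊥
  not-two-generated rank generates s₁ s₂ s₃ = 3≰2 (rank-bound rank generates members)
    where
      members : ∀ {z} → z ∈ₗ _ → InSpan G _ z
      members (here refl)                 = s₁
      members (there (here refl))         = s₂
      members (there (there (here refl))) = s₃

      3≰2 : ¬ (3 ≤ 2)
      3≰2 (s≤s (s≤s ()))

  module Closure (L : List (Fin n)) (P : Fin n → Set)
                 (finite : ∀ {s} → s ∈ₗ L → ∃ λ m → pow G s (suc m) ≡ ε)
                 (step : ∀ {s} → s ∈ₗ L → ∀ z → P z → P (s ∙ z)) where
    open GroupFacts G

    Invariant : Fin n → Set
    Invariant w = ∀ z → (P z → P (w ∙ z)) × (P (w ∙ z) → P z)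

    powers : ∀ {s} → s ∈ₗ L → ∀ j z → P z → P (pow G s j ∙ z)
    powers s∈L zero    z Pz = subst P (sym (identityˡ z)) Pz
    powers s∈L (suc j) z Pz = subst P (sym (assoc _ _ z)) (powers s∈L j _ (step s∈L z Pz))

    -- a generator s of order m+1 is undone by s^m
    generator-invariant : ∀ {s} → s ∈ₗ L → Invariant s
    generator-invariant {s} s∈L z = step s∈L z , backwards
      where
        backwards : P (s ∙ z) → P z
        backwards Psz with finite s∈L
        ... | m , sᵐ⁺¹≡ε = subst P cancel (powers s∈L m (s ∙ z) Psz)
          where
            cancel : pow G s m ∙ (s ∙ z) ≡ z
            cancel = trans (sym (assoc _ _ z)) (trans (cong (_∙ z) sᵐ⁺¹≡ε) (identityˡ z))

    span-invariant : ∀ {w} → InSpan G L w → Invariant w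
    span-invariant (gen s∈L) = generator-invariant s∈L
    span-invariant one z     = subst P (sym (identityˡ z)) , subst P (identityˡ z)
    span-invariant (mul {u} {v} p q) z =
      (λ Pz → subst P (sym (assoc u v z)) (proj₁ (span-invariant p _) (proj₁ (span-invariant q z) Pz))) ,
      (λ Puvz → proj₂ (span-invariant q z) (proj₂ (span-invariant p _) (subst P (assoc u v z) Puvz)))
    span-invariant (inv {u} p) z =
      (λ Pz → proj₂ (span-invariant p _) (subst P (sym cancel) Pz)) ,
      (λ Pu⁻¹z → subst P cancel (proj₁ (span-invariant p _) Pu⁻¹z))
      where
        cancel : u ∙ (u ⁻¹ ∙ z) ≡ z
        cancel = trans (sym (assoc _ _ z)) (trans (cong (_∙ z) (inverseʳ u)) (identityˡ z))

module _ {n : ℕ} where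
  open import Data.List.Membership.DecPropositional (Fin._≟_ {n}) using () renaming (_∈?_ to _∈ₗ?_)

  listSubset : List (Fin n) → Subset n
  listSubset L = Vec.tabulate (λ z → does (z ∈ₗ? L))

  ∈-listSubset⁺ : ∀ {L z} → z ∈ₗ L → z ∈ listSubset L
  ∈-listSubset⁺ {L} {z} z∈L = lookup⇒[]= z _ (trans (lookup∘tabulate _ z) (dec-true (z ∈ₗ? L) z∈L))

  ∈-listSubset⁻ : ∀ {L z} → z ∈ listSubset L → z ∈ₗ L
  ∈-listSubset⁻ {L} {z} z∈S with z ∈ₗ? L | trans (sym (lookup∘tabulate _ z)) ([]=⇒lookup z∈S)
  ... | yes z∈L | _  = z∈L
  ... | no  _   | ()

module Cayley {n : ℕ} (G : FinGroup n) (S : Subset n) where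
  open FinGroup G
  open GroupFacts G

  -- right translations preserve the difference v u⁻¹, hence arcs and non-arcs
  translation-isAut : ∀ φ → IsRightTranslation G φ → IsCayAut G S φ
  translation-isAut φ (g , φ≡·g) u v = subst (_∈ S) (sym difference) , subst (_∈ S) difference
    where
      difference : (φ ⟨$⟩ʳ v) ∙ (φ ⟨$⟩ʳ u) ⁻¹ ≡ v ∙ u ⁻¹
      difference = trans (cong₂ (λ p q → p ∙ q ⁻¹) (φ≡·g v) (φ≡·g u)) (right-invariant v g u)

  record Normalised : Set where
    field
      apply          : Fin n → Fin n
      apply-ε        : apply ε ≡ ε
      injective      : ∀ {u v} → apply u ≡ apply v → u ≡ v
      preserves-arcs : ∀ {u v} → Arc G S u v → Arc G S (apply u) (apply v)

  normalise : ∀ φ → IsCayAut G S φ → Fin n → Normalised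
  normalise φ aut z = record
    { apply          = χ
    ; apply-ε        = trans (cong (λ u → f u ∙ f z ⁻¹) (identityˡ z)) (inverseʳ (f z))
    ; injective      = λ {u} {v} χu≡χv →
        ∙-cancelʳ z u v (f-injective (∙-cancelʳ (f z ⁻¹) (f (u ∙ z)) (f (v ∙ z)) χu≡χv))
    ; preserves-arcs = λ {u} {v} uv →
        subst (_∈ S) (sym (right-invariant (f (v ∙ z)) (f z ⁻¹) (f (u ∙ z))))
          (proj₁ (aut (u ∙ z) (v ∙ z)) (subst (_∈ S) (sym (right-invariant v z u)) uv))
    }
    where
      f : Fin n → Fin n
      f u = φ ⟨$⟩ʳ u

      f-injective : ∀ {u v} → f u ≡ f v → u ≡ v
      f-injective {u} {v} fu≡fv = trans (sym (inverseˡ-perm φ)) (trans (cong (φ ⟨$⟩ˡ_) fu≡fv) (inverseˡ-perm φ))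

      χ : Fin n → Fin n
      χ u = f (u ∙ z) ∙ f z ⁻¹

  -- Indeed the set
  -- of z with φ(z) = z g contains 1 and is closed under z ↦ s z for s ∈ L.
  automorphism-isTranslation :
    ∀ {L} → Generates G L → (∀ {s} → s ∈ₗ L → ∃ λ m → pow G s (suc m) ≡ ε) →
    (∀ (χ : Normalised) {s} → s ∈ₗ L → Normalised.apply χ s ≡ s) →
    ∀ φ → IsCayAut G S φ → IsRightTranslation G φ
  automorphism-isTranslation {L} generates finite fixes φ aut = g , λ w →
    subst Translated (identityʳ w) (proj₁ (span-invariant (generates w) ε) (sym (identityˡ g)))
    where
      f : Fin n → Fin n
      f u = φ ⟨$⟩ʳ u

      g : Fin n
      g = f ε

      Translated : Fin n → Set
      Translated z = f z ≡ z ∙ g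

      step : ∀ {s} → s ∈ₗ L → ∀ z → Translated z → Translated (s ∙ z)
      step {s} s∈L z fz≡zg = begin
        f (s ∙ z)                ≡⟨ sym (//-rightDividesˡ (f z) _) ⟩
        f (s ∙ z) ∙ f z ⁻¹ ∙ f z ≡⟨ cong₂ _∙_ (fixes (normalise φ aut z) s∈L) fz≡zg ⟩
        s ∙ (z ∙ g)              ≡⟨ sym (assoc s z g) ⟩
        s ∙ z ∙ g                ∎
        where open ≡-Reasoning

      open Spans.Closure G L Translated finite step using (span-invariant)

a⁺ a⁻ b⁺ b⁻ c⁺ c⁻ : Letter 3
a⁺ = zero , false
a⁻ = zero , true
b⁺ = suc zero , false
b⁻ = suc zero , true
c⁺ = suc (suc zero) , false
c⁻ = suc (suc zero) , true

data Label : Set where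
  A B C X Y : Label

labels : List Label
labels = A ∷ B ∷ C ∷ X ∷ Y ∷ []

label∈labels : ∀ s → s ∈ₗ labels
label∈labels A = here refl
label∈labels B = there (here refl)
label∈labels C = there (there (here refl))
label∈labels X = there (there (there (here refl)))
label∈labels Y = there (there (there (there (here refl))))

every : ∀ (f : Label → Bool) → T (all f labels) → ∀ s → T (f s)
every f ok s = All.lookup (all⁺ f labels ok) (label∈labels s)

word : Label → Word 3
word A = a⁺ ∷ []
word B = b⁺ ∷ []
word C = c⁺ ∷ []
word X = b⁺ ∷ a⁻ ∷ []
word Y = c⁺ ∷ b⁻ ∷ []

commutatorBC : Word 3
commutatorBC = commutatorWord (suc zero) (suc (suc zero))

-- the only arcs s → t between elements of S that are not excluded below;
-- the first three (a → b, b → c, y → c) are genuinely present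
data Permitted : Label → Label → Set where
  ab : Permitted A B
  bc : Permitted B C
  yc : Permitted Y C
  xa : Permitted X A
  bx : Permitted B X

-- Among the permitted arcs only c has two distinct in-neighbours, y has
-- none, and b has only a.
pinned : ∀ {pa pb pc py} → Permitted pa pb → Permitted pb pc → Permitted py pc → pb ≢ py →
         pa ≡ A × pb ≡ B × pc ≡ C
pinned ab bc yc _   = refl , refl , refl
pinned _  ab ab b≢y = ⊥-elim (b≢y refl)
pinned _  bc bc b≢y = ⊥-elim (b≢y refl)
pinned _  xa xa b≢y = ⊥-elim (b≢y refl)
pinned _  bx bx b≢y = ⊥-elim (b≢y refl)

-- The consequences of an equation among elements of S that contradict the
-- hypotheses: an element of order > 2 being 1 or an involution, [a,b] = 1,
-- or G being generated by two elements (c ∈ ⟨a,b⟩, b ∈ ⟨a,c⟩, or b = y²,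
-- which gives G = ⟨a, y⟩ since c = y b).
data Absurdity : Set where
  trivial involution : Label → Absurdity
  [a,b]≡1 b≡y²       : Absurdity
  c∈⟨a,b⟩ b∈⟨a,c⟩    : Word 3 → Absurdity

equation : Absurdity → Word 3 × Word 3
equation (trivial s)    = word s , []
equation (involution s) = word s ++ word s , []
equation [a,b]≡1        = commutatorWord zero (suc zero) , []
equation b≡y²           = b⁺ ∷ [] , word Y ++ word Y
equation (c∈⟨a,b⟩ w)    = c⁺ ∷ [] , w
equation (b∈⟨a,c⟩ w)    = b⁺ ∷ [] , w

-- the words witnessing membership in ⟨a,b⟩ (resp. ⟨a,c⟩) must use only a, b (resp. a, c)
Over : List (Fin 3) → Word 3 → Set
Over I w = All (λ l → proj₁ l ∈ₗ I) w

over? : ∀ I w → Dec (Over I w)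
over? I w = All.all? (λ l → proj₁ l ∈? I) w

admissible : Absurdity → Bool
admissible (c∈⟨a,b⟩ w) = isYes (over? (zero ∷ suc zero ∷ []) w)
admissible (b∈⟨a,c⟩ w) = isYes (over? (zero ∷ suc (suc zero) ∷ []) w)
admissible _           = true

-- A certificate refuting a relation r: a derivation, from r and [b,c] = 1,
-- of the equation of an absurdity.
Certificate : Set
Certificate = Absurdity × List Step

hyp bc=cb : ℕ
hyp   = 0
bc=cb = 1

refutes : Word 3 → Certificate → Bool
refutes r (t , ss) = admissible t ∧ Derives (r ∷ commutatorBC ∷ []) ss (proj₁ (equation t)) (proj₂ (equation t))

data Verdict (P : Set) : Set where
  holds   : P → Verdict P
  refuted : Certificate → Verdict P

settles : ∀ {P} → Word 3 → Verdict P → Bool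
settles r (holds _)   = true
settles r (refuted c) = refutes r c

-- An arc s → t inside S means t s⁻¹ = r for some r ∈ S.  For each triple
-- (s, t, r), either s → t is permitted or the relation t s⁻¹ r⁻¹ is refuted.
arcRelator : Label → Label → Label → Word 3
arcRelator s t r = word t ++ invWord (word s) ++ invWord (word r)

arcVerdict : (s t r : Label) → Verdict (Permitted s t)
arcVerdict A A A = refuted (trivial A , ins 0 hyp as-is 0 ∷ [])
arcVerdict A A B = refuted (trivial B , ins 0 hyp as-is 0 ∷ [])
arcVerdict A A C = refuted (trivial C , ins 0 hyp as-is 0 ∷ [])
arcVerdict A A X = refuted (trivial X , ins 0 hyp as-is 0 ∷ [])
arcVerdict A A Y = refuted (trivial Y , ins 0 hyp as-is 0 ∷ [])
arcVerdict A B _ = holds ab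
arcVerdict A C A = refuted (c∈⟨a,b⟩ (a⁺ ∷ a⁺ ∷ []) , ins 0 hyp inverted 0 ∷ [])
arcVerdict A C B = refuted ([a,b]≡1 , ins 0 hyp inverted 2 ∷ ins 0 bc=cb as-is 0 ∷ ins 1 hyp as-is 1 ∷ [])
arcVerdict A C C = refuted (trivial A , ins 0 hyp as-is 1 ∷ [])
arcVerdict A C X = refuted (trivial Y , ins 0 hyp inverted 0 ∷ [])
arcVerdict A C Y = refuted (trivial X , ins 0 hyp inverted 2 ∷ [])
arcVerdict A X A = refuted ([a,b]≡1 , ins 0 hyp inverted 3 ∷ ins 1 hyp as-is 3 ∷ [])
arcVerdict A X B = refuted (involution A , ins 0 hyp as-is 1 ∷ [])
arcVerdict A X C = refuted (c∈⟨a,b⟩ (b⁺ ∷ a⁻ ∷ a⁻ ∷ []) , ins 0 hyp as-is 0 ∷ [])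
arcVerdict A X X = refuted (trivial A , ins 0 hyp as-is 1 ∷ [])
arcVerdict A X Y = refuted (c∈⟨a,b⟩ (b⁺ ∷ a⁻ ∷ a⁻ ∷ b⁺ ∷ []) , ins 0 hyp as-is 0 ∷ [])
arcVerdict A Y A = refuted (c∈⟨a,b⟩ (a⁺ ∷ a⁺ ∷ b⁺ ∷ []) , ins 0 hyp inverted 0 ∷ [])
arcVerdict A Y B = refuted ([a,b]≡1 , ins 0 hyp as-is 1 ∷ ins 2 bc=cb as-is 3 ∷ ins 2 hyp inverted 0 ∷ [])
arcVerdict A Y C = refuted ([a,b]≡1 , ins 0 hyp as-is 1 ∷ ins 2 hyp inverted 2 ∷ [])
arcVerdict A Y X = refuted (c∈⟨a,b⟩ (b⁺ ∷ b⁺ ∷ []) , ins 0 hyp inverted 0 ∷ [])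
arcVerdict A Y Y = refuted (trivial A , ins 0 hyp as-is 2 ∷ [])
arcVerdict B A A = refuted (trivial B , ins 0 hyp as-is 1 ∷ [])
arcVerdict B A B = refuted ([a,b]≡1 , ins 0 hyp as-is 1 ∷ ins 1 hyp inverted 2 ∷ [])
arcVerdict B A C = refuted ([a,b]≡1 , ins 0 hyp as-is 1 ∷ ins 1 hyp inverted 2 ∷ ins 2 bc=cb as-is 2 ∷ [])
arcVerdict B A X = refuted (involution X , ins 0 hyp as-is 0 ∷ [])
arcVerdict B A Y = refuted ([a,b]≡1 , ins 0 hyp as-is 1 ∷ ins 0 bc=cb as-is 0 ∷ ins 1 hyp inverted 1 ∷ [])
arcVerdict B B A = refuted (trivial A , ins 0 hyp as-is 0 ∷ [])
arcVerdict B B B = refuted (trivial B , ins 0 hyp as-is 0 ∷ [])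
arcVerdict B B C = refuted (trivial C , ins 0 hyp as-is 0 ∷ [])
arcVerdict B B X = refuted (trivial X , ins 0 hyp as-is 0 ∷ [])
arcVerdict B B Y = refuted (trivial Y , ins 0 hyp as-is 0 ∷ [])
arcVerdict B C _ = holds bc
arcVerdict B X _ = holds bx
arcVerdict B Y A = refuted ([a,b]≡1 , ins 0 hyp as-is 2 ∷ ins 3 hyp inverted 2 ∷ ins 2 bc=cb as-is 2 ∷ [])
arcVerdict B Y B = refuted (c∈⟨a,b⟩ (b⁺ ∷ b⁺ ∷ b⁺ ∷ []) , ins 0 hyp inverted 0 ∷ [])
arcVerdict B Y C = refuted (involution B , ins 0 hyp as-is 1 ∷ [])
arcVerdict B Y X = refuted ([a,b]≡1 , ins 0 hyp as-is 4 ∷ ins 1 bc=cb inverted 1 ∷ ins 1 hyp inverted 1 ∷ [])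
arcVerdict B Y Y = refuted (trivial B , ins 0 hyp as-is 1 ∷ [])
arcVerdict C A A = refuted (trivial C , ins 0 hyp as-is 1 ∷ [])
arcVerdict C A B = refuted ([a,b]≡1 , ins 0 hyp as-is 1 ∷ ins 0 bc=cb as-is 0 ∷ ins 1 hyp inverted 2 ∷ [])
arcVerdict C A C = refuted ([a,b]≡1 , ins 0 hyp as-is 1 ∷ ins 0 bc=cb as-is 0 ∷ ins 1 hyp inverted 2 ∷ ins 2 bc=cb as-is 2 ∷ [])
arcVerdict C A X = refuted (c∈⟨a,b⟩ (a⁺ ∷ b⁻ ∷ a⁺ ∷ []) , ins 0 hyp as-is 2 ∷ [])
arcVerdict C A Y = refuted ([a,b]≡1 , ins 0 hyp as-is 1 ∷ ins 0 bc=cb as-is 0 ∷ ins 1 hyp inverted 3 ∷ ins 2 bc=cb as-is 2 ∷ [])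
arcVerdict C B A = refuted ([a,b]≡1 , ins 0 hyp inverted 1 ∷ ins 0 bc=cb inverted 1 ∷ ins 1 hyp as-is 2 ∷ [])
arcVerdict C B B = refuted (trivial C , ins 0 hyp as-is 1 ∷ [])
arcVerdict C B C = refuted (b∈⟨a,c⟩ (c⁺ ∷ c⁺ ∷ []) , ins 0 hyp inverted 0 ∷ [])
arcVerdict C B X = refuted ([a,b]≡1 , ins 0 hyp as-is 1 ∷ ins 0 bc=cb as-is 0 ∷ ins 1 hyp inverted 1 ∷ [])
arcVerdict C B Y = refuted (involution Y , ins 0 hyp as-is 0 ∷ [])
arcVerdict C C A = refuted (trivial A , ins 0 hyp as-is 0 ∷ [])
arcVerdict C C B = refuted (trivial B , ins 0 hyp as-is 0 ∷ [])
arcVerdict C C C = refuted (trivial C , ins 0 hyp as-is 0 ∷ [])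
arcVerdict C C X = refuted (trivial X , ins 0 hyp as-is 0 ∷ [])
arcVerdict C C Y = refuted (trivial Y , ins 0 hyp as-is 0 ∷ [])
arcVerdict C X A = refuted (c∈⟨a,b⟩ (a⁻ ∷ b⁺ ∷ a⁻ ∷ []) , ins 0 hyp as-is 3 ∷ [])
arcVerdict C X B = refuted ([a,b]≡1 , ins 0 hyp inverted 1 ∷ ins 0 bc=cb inverted 1 ∷ ins 1 hyp as-is 1 ∷ [])
arcVerdict C X C = refuted ([a,b]≡1 , ins 0 hyp inverted 3 ∷ ins 1 bc=cb inverted 1 ∷ ins 1 hyp as-is 1 ∷ ins 2 bc=cb inverted 3 ∷ [])
arcVerdict C X X = refuted (trivial C , ins 0 hyp as-is 2 ∷ [])
arcVerdict C X Y = refuted ([a,b]≡1 , ins 0 hyp inverted 4 ∷ ins 1 bc=cb inverted 1 ∷ ins 1 hyp as-is 1 ∷ ins 2 bc=cb inverted 3 ∷ [])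
arcVerdict C Y A = refuted ([a,b]≡1 , ins 0 hyp as-is 0 ∷ ins 0 bc=cb inverted 1 ∷ ins 2 hyp inverted 1 ∷ ins 2 bc=cb as-is 2 ∷ [])
arcVerdict C Y B = refuted (involution B , ins 0 hyp as-is 0 ∷ ins 0 bc=cb inverted 1 ∷ [])
arcVerdict C Y C = refuted (c∈⟨a,b⟩ (b⁻ ∷ []) , ins 0 hyp as-is 1 ∷ [])
arcVerdict C Y X = refuted ([a,b]≡1 , ins 0 hyp as-is 4 ∷ ins 1 bc=cb inverted 1 ∷ ins 1 hyp inverted 1 ∷ ins 2 bc=cb as-is 2 ∷ [])
arcVerdict C Y Y = refuted (trivial C , ins 0 hyp as-is 2 ∷ [])
arcVerdict X A _ = holds xa
arcVerdict X B A = refuted ([a,b]≡1 , ins 0 hyp as-is 2 ∷ [])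
arcVerdict X B B = refuted (trivial X , ins 0 hyp as-is 1 ∷ [])
arcVerdict X B C = refuted ([a,b]≡1 , ins 0 hyp as-is 2 ∷ ins 1 hyp inverted 2 ∷ ins 2 bc=cb as-is 3 ∷ [])
arcVerdict X B X = refuted ([a,b]≡1 , ins 0 hyp as-is 2 ∷ ins 1 hyp inverted 1 ∷ [])
arcVerdict X B Y = refuted ([a,b]≡1 , ins 0 hyp as-is 2 ∷ ins 0 bc=cb as-is 0 ∷ ins 1 hyp inverted 1 ∷ [])
arcVerdict X C A = refuted (c∈⟨a,b⟩ (a⁺ ∷ b⁺ ∷ a⁻ ∷ []) , ins 0 hyp inverted 0 ∷ [])
arcVerdict X C B = refuted ([a,b]≡1 , ins 0 hyp as-is 2 ∷ ins 1 hyp inverted 2 ∷ ins 2 bc=cb inverted 3 ∷ [])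
arcVerdict X C C = refuted (trivial X , ins 0 hyp as-is 1 ∷ [])
arcVerdict X C X = refuted (c∈⟨a,b⟩ (b⁺ ∷ a⁻ ∷ b⁺ ∷ a⁻ ∷ []) , ins 0 hyp inverted 0 ∷ [])
arcVerdict X C Y = refuted (trivial A , ins 0 hyp inverted 1 ∷ [])
arcVerdict X X A = refuted (trivial A , ins 0 hyp as-is 0 ∷ [])
arcVerdict X X B = refuted (trivial B , ins 0 hyp as-is 0 ∷ [])
arcVerdict X X C = refuted (trivial C , ins 0 hyp as-is 0 ∷ [])
arcVerdict X X X = refuted (trivial X , ins 0 hyp as-is 0 ∷ [])
arcVerdict X X Y = refuted (trivial Y , ins 0 hyp as-is 0 ∷ [])
arcVerdict X Y A = refuted (c∈⟨a,b⟩ (a⁺ ∷ b⁺ ∷ a⁻ ∷ b⁺ ∷ []) , ins 0 hyp inverted 0 ∷ [])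
arcVerdict X Y B = refuted ([a,b]≡1 , ins 0 hyp as-is 3 ∷ ins 2 bc=cb inverted 1 ∷ ins 1 hyp inverted 2 ∷ [])
arcVerdict X Y C = refuted ([a,b]≡1 , ins 0 hyp as-is 3 ∷ ins 1 hyp inverted 2 ∷ [])
arcVerdict X Y X = refuted (c∈⟨a,b⟩ (b⁺ ∷ a⁻ ∷ b⁺ ∷ a⁻ ∷ b⁺ ∷ []) , ins 0 hyp inverted 0 ∷ [])
arcVerdict X Y Y = refuted (trivial X , ins 0 hyp as-is 2 ∷ [])
arcVerdict Y A A = refuted (trivial Y , ins 0 hyp as-is 1 ∷ [])
arcVerdict Y A B = refuted ([a,b]≡1 , ins 0 hyp as-is 1 ∷ ins 0 bc=cb as-is 1 ∷ ins 0 hyp inverted 2 ∷ [])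
arcVerdict Y A C = refuted ([a,b]≡1 , ins 0 hyp as-is 1 ∷ ins 0 bc=cb as-is 1 ∷ ins 0 hyp inverted 2 ∷ ins 2 bc=cb as-is 2 ∷ [])
arcVerdict Y A X = refuted (c∈⟨a,b⟩ (a⁺ ∷ b⁻ ∷ a⁺ ∷ b⁺ ∷ []) , ins 0 hyp as-is 3 ∷ [])
arcVerdict Y A Y = refuted ([a,b]≡1 , ins 0 hyp as-is 1 ∷ ins 0 bc=cb as-is 1 ∷ ins 0 hyp inverted 3 ∷ ins 2 bc=cb as-is 2 ∷ [])
arcVerdict Y B A = refuted ([a,b]≡1 , ins 0 hyp inverted 1 ∷ ins 0 bc=cb inverted 1 ∷ ins 1 hyp as-is 3 ∷ [])
arcVerdict Y B B = refuted (trivial Y , ins 0 hyp as-is 1 ∷ [])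
arcVerdict Y B C = refuted (involution Y , ins 0 hyp as-is 0 ∷ ins 1 bc=cb as-is 1 ∷ [])
arcVerdict Y B X = refuted ([a,b]≡1 , ins 0 hyp as-is 1 ∷ ins 0 hyp inverted 3 ∷ ins 2 bc=cb as-is 2 ∷ [])
arcVerdict Y B Y = refuted (b≡y² , ins 0 hyp inverted 0 ∷ [])
arcVerdict Y C _ = holds yc
arcVerdict Y X A = refuted (c∈⟨a,b⟩ (a⁻ ∷ b⁺ ∷ a⁻ ∷ b⁺ ∷ []) , ins 0 hyp as-is 4 ∷ [])
arcVerdict Y X B = refuted ([a,b]≡1 , ins 0 hyp inverted 1 ∷ ins 0 bc=cb inverted 1 ∷ ins 1 hyp as-is 1 ∷ [])
arcVerdict Y X C = refuted ([a,b]≡1 , ins 0 hyp inverted 4 ∷ ins 1 bc=cb inverted 1 ∷ ins 3 bc=cb inverted 2 ∷ ins 1 hyp as-is 1 ∷ [])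
arcVerdict Y X X = refuted (trivial Y , ins 0 hyp as-is 2 ∷ [])
arcVerdict Y X Y = refuted ([a,b]≡1 , ins 0 hyp inverted 5 ∷ ins 1 bc=cb inverted 1 ∷ ins 3 bc=cb inverted 1 ∷ ins 1 hyp as-is 1 ∷ [])
arcVerdict Y Y A = refuted (trivial A , ins 0 hyp as-is 0 ∷ [])
arcVerdict Y Y B = refuted (trivial B , ins 0 hyp as-is 0 ∷ [])
arcVerdict Y Y C = refuted (trivial C , ins 0 hyp as-is 0 ∷ [])
arcVerdict Y Y X = refuted (trivial X , ins 0 hyp as-is 0 ∷ [])
arcVerdict Y Y Y = refuted (trivial Y , ins 0 hyp as-is 0 ∷ [])

arcSettled : Label → Label → Label → Bool
arcSettled s t r = settles (arcRelator s t r) (arcVerdict s t r)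

arcTable-valid : ∀ s t r → T (arcSettled s t r)
arcTable-valid s t r =
  every (arcSettled s t) (every (λ t → all (arcSettled s t) labels) (every (λ s → all (λ t → all (arcSettled s t) labels) labels) tt s) t) r

-- S ∩ S⁻¹ = ∅: each relation s⁻¹ = r, i.e. s r = 1, is refuted.
inverseRelator : Label → Label → Word 3
inverseRelator s r = word s ++ word r

inverseCertificate : Label → Label → Certificate
inverseCertificate A A = (involution A , ins 0 hyp inverted 0 ∷ [])
inverseCertificate A B = ([a,b]≡1 , ins 0 hyp as-is 1 ∷ ins 0 hyp inverted 0 ∷ [])
inverseCertificate A C = ([a,b]≡1 , ins 0 hyp as-is 1 ∷ ins 0 bc=cb inverted 1 ∷ ins 1 hyp inverted 1 ∷ [])
inverseCertificate A X = (trivial B , ins 0 hyp inverted 1 ∷ [])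
inverseCertificate A Y = ([a,b]≡1 , ins 0 hyp as-is 1 ∷ ins 0 bc=cb inverted 1 ∷ ins 1 hyp inverted 2 ∷ [])
inverseCertificate B A = ([a,b]≡1 , ins 0 hyp as-is 0 ∷ ins 0 hyp inverted 1 ∷ [])
inverseCertificate B B = (involution B , ins 0 hyp inverted 0 ∷ [])
inverseCertificate B C = (c∈⟨a,b⟩ (b⁻ ∷ []) , ins 0 hyp inverted 1 ∷ [])
inverseCertificate B X = ([a,b]≡1 , ins 0 hyp inverted 1 ∷ ins 1 hyp as-is 2 ∷ [])
inverseCertificate B Y = (trivial C , ins 0 hyp inverted 1 ∷ [])
inverseCertificate C A = ([a,b]≡1 , ins 0 hyp as-is 0 ∷ ins 0 bc=cb inverted 1 ∷ ins 1 hyp inverted 0 ∷ [])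
inverseCertificate C B = (c∈⟨a,b⟩ (b⁻ ∷ []) , ins 0 hyp inverted 0 ∷ [])
inverseCertificate C C = (involution C , ins 0 hyp inverted 0 ∷ [])
inverseCertificate C X = ([a,b]≡1 , ins 0 hyp inverted 1 ∷ ins 1 hyp as-is 2 ∷ ins 2 bc=cb as-is 2 ∷ [])
inverseCertificate C Y = (b∈⟨a,c⟩ (c⁺ ∷ c⁺ ∷ []) , ins 0 hyp as-is 0 ∷ [])
inverseCertificate X A = (trivial B , ins 0 hyp inverted 0 ∷ [])
inverseCertificate X B = ([a,b]≡1 , ins 0 hyp inverted 2 ∷ ins 1 hyp as-is 1 ∷ [])
inverseCertificate X C = ([a,b]≡1 , ins 0 hyp inverted 2 ∷ ins 1 hyp as-is 1 ∷ ins 2 bc=cb as-is 2 ∷ [])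
inverseCertificate X X = (involution X , ins 0 hyp inverted 0 ∷ [])
inverseCertificate X Y = ([a,b]≡1 , ins 0 hyp inverted 1 ∷ ins 0 bc=cb as-is 0 ∷ ins 1 hyp as-is 1 ∷ [])
inverseCertificate Y A = ([a,b]≡1 , ins 0 hyp as-is 0 ∷ ins 0 bc=cb inverted 1 ∷ ins 1 hyp inverted 0 ∷ [])
inverseCertificate Y B = (trivial C , ins 0 hyp inverted 0 ∷ [])
inverseCertificate Y C = (b∈⟨a,c⟩ (c⁺ ∷ c⁺ ∷ []) , ins 0 hyp as-is 2 ∷ [])
inverseCertificate Y X = ([a,b]≡1 , ins 0 hyp inverted 1 ∷ ins 0 bc=cb as-is 0 ∷ ins 1 hyp as-is 1 ∷ [])
inverseCertificate Y Y = (involution Y , ins 0 hyp inverted 0 ∷ [])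

inverseRefuted : Label → Label → Bool
inverseRefuted s r = refutes (inverseRelator s r) (inverseCertificate s r)

inverseTable-valid : ∀ s r → T (inverseRefuted s r)
inverseTable-valid s r = every (inverseRefuted s) (every (λ s → all (inverseRefuted s) labels) tt s) r

module Setting {n : ℕ} (G : FinGroup n) (a b c : Fin n)
  (rank : RankIs G 3) (generates : Generates G (a ∷ b ∷ c ∷ []))
  (order-a : OrderGt2 G a) (order-b : OrderGt2 G b) (order-c : OrderGt2 G c)
  (order-x : OrderGt2 G (FinGroup._∙_ G b (FinGroup._⁻¹ G a)))
  (order-y : OrderGt2 G (FinGroup._∙_ G c (FinGroup._⁻¹ G b)))
  ([a,b]≢1 : comm G a b ≢ FinGroup.ε G) ([b,c]≡1 : comm G b c ≡ FinGroup.ε G) where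

  open FinGroup G
  open GroupFacts G
  open Spans G using (not-two-generated)
  open ≡-Reasoning

  ρ : Fin 3 → Fin n
  ρ zero             = a
  ρ (suc zero)       = b
  ρ (suc (suc zero)) = c

  open Evaluation G ρ

  x y : Fin n
  x = b ∙ a ⁻¹
  y = c ∙ b ⁻¹

  elt : Label → Fin n
  elt A = a
  elt B = b
  elt C = c
  elt X = x
  elt Y = y

  elt≡ev : ∀ s → elt s ≡ ev (word s)
  elt≡ev A = sym (identityʳ a)
  elt≡ev B = sym (identityʳ b)
  elt≡ev C = sym (identityʳ c)
  elt≡ev X = cong (b ∙_) (sym (identityʳ (a ⁻¹)))
  elt≡ev Y = cong (c ∙_) (sym (identityʳ (b ⁻¹)))

  order>2 : ∀ s → OrderGt2 G (elt s)
  order>2 A = order-a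
  order>2 B = order-b
  order>2 C = order-c
  order>2 X = order-x
  order>2 Y = order-y

  commutatorBC-relator : ev commutatorBC ≡ ε
  commutatorBC-relator = trans (ev-commutatorWord (suc zero) (suc (suc zero))) [b,c]≡1

  y∙b≡c : y ∙ b ≡ c
  y∙b≡c = //-rightDividesˡ b c

  c∉⟨a,b⟩ : ¬ InSpan G (a ∷ b ∷ []) c
  c∉⟨a,b⟩ = not-two-generated rank generates (gen (here refl)) (gen (there (here refl)))

  b∉⟨a,c⟩ : ¬ InSpan G (a ∷ c ∷ []) b
  b∉⟨a,c⟩ b∈ = not-two-generated rank generates (gen (here refl)) b∈ (gen (there (here refl)))

  -- b = y² would give c = y b = y³, so G = ⟨a, y⟩
  b≢y² : b ≢ y ∙ y
  b≢y² b≡yy = not-two-generated rank generates (gen (here refl)) b∈⟨a,y⟩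
    (subst (InSpan G _) y∙b≡c (mul y∈⟨a,y⟩ b∈⟨a,y⟩))
    where
      y∈⟨a,y⟩ : InSpan G (a ∷ y ∷ []) y
      y∈⟨a,y⟩ = gen (there (here refl))
      b∈⟨a,y⟩ : InSpan G (a ∷ y ∷ []) b
      b∈⟨a,y⟩ = subst (InSpan G _) (sym b≡yy) (mul y∈⟨a,y⟩ y∈⟨a,y⟩)

  -- b = y would give c = y b = b², so G = ⟨a, b⟩
  b≢y : b ≢ y
  b≢y b≡y = c∉⟨a,b⟩ (subst (InSpan G _) (trans (cong (_∙ b) b≡y) y∙b≡c) (mul b∈ b∈))
    where
      b∈ : InSpan G (a ∷ b ∷ []) b
      b∈ = gen (there (here refl))

  absurd : ∀ t → T (admissible t) → ev (proj₁ (equation t)) ≡ ev (proj₂ (equation t)) → ⊥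
  absurd (trivial s)    _ s≡1 = order>2⇒≢ε (order>2 s) (trans (elt≡ev s) s≡1)
  absurd (involution s) _ s²≡1 = order>2⇒square≢ε (order>2 s) (begin
    elt s ∙ elt s                 ≡⟨ cong₂ _∙_ (elt≡ev s) (elt≡ev s) ⟩
    ev (word s) ∙ ev (word s)     ≡⟨ sym (ev-++ (word s) (word s)) ⟩
    ev (word s ++ word s)         ≡⟨ s²≡1 ⟩
    ε                             ∎)
  absurd [a,b]≡1 _ e = [a,b]≢1 (trans (sym (ev-commutatorWord zero (suc zero))) e)
  absurd b≡y² _ e = b≢y² (begin
    b                             ≡⟨ elt≡ev B ⟩
    ev (word B)                   ≡⟨ e ⟩
    ev (word Y ++ word Y)         ≡⟨ ev-++ (word Y) (word Y) ⟩
    ev (word Y) ∙ ev (word Y)     ≡⟨ sym (cong₂ _∙_ (elt≡ev Y) (elt≡ev Y)) ⟩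
    y ∙ y                         ∎)
  absurd (c∈⟨a,b⟩ w) over c≡w = c∉⟨a,b⟩
    (subst (InSpan G _) (sym (trans (elt≡ev C) c≡w)) (word-in-span w (toWitness over)))
  absurd (b∈⟨a,c⟩ w) over b≡w = b∉⟨a,c⟩
    (subst (InSpan G _) (sym (trans (elt≡ev B) b≡w)) (word-in-span w (toWitness over)))

  refute : ∀ {r} cert → ev r ≡ ε → T (refutes r cert) → ⊥
  refute {r} (t , ss) r≡1 ok with Equivalence.to T-∧ ok
  ... | adm , derivation = absurd t adm
    (derives-sound (r≡1 ∷ commutatorBC-relator ∷ []) ss (proj₁ (equation t)) (proj₂ (equation t)) derivation)

  decide : ∀ {P r} (v : Verdict P) → ev r ≡ ε → T (settles r v) → P
  decide (holds p)      _   _  = p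
  decide (refuted cert) r≡1 ok = ⊥-elim (refute cert r≡1 ok)

  permitted : ∀ s t r → elt t ∙ elt s ⁻¹ ≡ elt r → Permitted s t
  permitted s t r e = decide (arcVerdict s t r) relator (arcTable-valid s t r)
    where
      relator : ev (arcRelator s t r) ≡ ε
      relator = begin
        ev (word t ++ invWord (word s) ++ invWord (word r))
          ≡⟨ trans (ev-++ (word t) _) (cong (ev (word t) ∙_) (ev-++ (invWord (word s)) _)) ⟩
        ev (word t) ∙ (ev (invWord (word s)) ∙ ev (invWord (word r)))
          ≡⟨ sym (assoc _ _ _) ⟩
        ev (word t) ∙ ev (invWord (word s)) ∙ ev (invWord (word r))
          ≡⟨ cong₂ (λ u v → u ∙ v ∙ ev (invWord (word r))) (sym (elt≡ev t)) (trans (ev-invWord (word s)) (cong _⁻¹ (sym (elt≡ev s)))) ⟩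
        elt t ∙ elt s ⁻¹ ∙ ev (invWord (word r))
          ≡⟨ cong₂ _∙_ (trans e (elt≡ev r)) (ev-invWord (word r)) ⟩
        ev (word r) ∙ ev (word r) ⁻¹
          ≡⟨ inverseʳ _ ⟩
        ε ∎

  no-inverse : ∀ s r → elt s ⁻¹ ≢ elt r
  no-inverse s r e = refute (inverseCertificate s r) relator (inverseTable-valid s r)
    where
      relator : ev (inverseRelator s r) ≡ ε
      relator = begin
        ev (word s ++ word r)       ≡⟨ ev-++ (word s) (word r) ⟩
        ev (word s) ∙ ev (word r)   ≡⟨ cong₂ _∙_ (sym (elt≡ev s)) (trans (sym (elt≡ev r)) (sym e)) ⟩
        elt s ∙ elt s ⁻¹            ≡⟨ inverseʳ _ ⟩
        ε                           ∎

  S : Subset n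
  S = listSubset (map elt labels)

  elt∈S : ∀ s → elt s ∈ S
  elt∈S s = ∈-listSubset⁺ (∈-map⁺ elt (label∈labels s))

  S-labelled : ∀ {z} → z ∈ S → ∃ λ s → z ≡ elt s
  S-labelled z∈S with ∈-map⁻ elt {xs = labels} (∈-listSubset⁻ z∈S)
  ... | s , _ , z≡s = s , z≡s

  S-asymmetric : ∀ z → z ∈ S → z ⁻¹ ∉ S
  S-asymmetric z z∈S z⁻¹∈S with S-labelled z∈S | S-labelled z⁻¹∈S
  ... | s , refl | r , e = no-inverse s r e

  -- the arcs a → b, b → c and y → c of Cay(G,S) (the last uses [b,c] = 1)
  arc-ab : Arc G S a b
  arc-ab = elt∈S X

  arc-bc : Arc G S b c
  arc-bc = elt∈S Y

  arc-yc : Arc G S y c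
  arc-yc = subst (_∈ S) (sym c∙y⁻¹≡b) (elt∈S B)
    where
      -- c b c⁻¹ = b: prefixing the relator b c b⁻¹ c⁻¹ reduces it to b
      c∙y⁻¹≡b : c ∙ y ⁻¹ ≡ b
      c∙y⁻¹≡b = begin
        c ∙ (c ∙ b ⁻¹) ⁻¹        ≡⟨ cong (c ∙_) (⁻¹-anti-homo-∙ c (b ⁻¹)) ⟩
        c ∙ (b ⁻¹ ⁻¹ ∙ c ⁻¹)     ≡⟨ cong (λ u → c ∙ (u ∙ c ⁻¹)) (⁻¹-involutive b) ⟩
        c ∙ (b ∙ c ⁻¹)           ≡⟨ cong (λ u → c ∙ (b ∙ u)) (sym (identityʳ _)) ⟩
        ev (c⁺ ∷ b⁺ ∷ c⁻ ∷ [])   ≡⟨ derives-sound {rs = commutatorBC ∷ []} (commutatorBC-relator ∷ []) (ins 0 0 as-is 2 ∷ []) (c⁺ ∷ b⁺ ∷ c⁻ ∷ []) (b⁺ ∷ []) tt ⟩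
        b ∙ ε                    ≡⟨ identityʳ b ⟩
        b                        ∎

  open Cayley G S

  -- every normalised arc-preserving map fixes a, b and c: it permutes the
  -- labels of S respecting arcs, so `pinned` applies
  module Fixing (χ : Normalised) where
    open Normalised χ

    image : ∀ s → ∃ λ s' → apply (elt s) ≡ elt s'
    image s = S-labelled (subst (_∈ S) (right-identity (apply (elt s))) arc)
      where
        right-identity : ∀ u → u ∙ ε ⁻¹ ≡ u
        right-identity u = trans (cong (u ∙_) ε⁻¹≈ε) (identityʳ u)
        arc : apply (elt s) ∙ ε ⁻¹ ∈ S
        arc = subst (λ e → apply (elt s) ∙ e ⁻¹ ∈ S) apply-ε
                (preserves-arcs (subst (_∈ S) (sym (right-identity (elt s))) (elt∈S s)))

    σ : Label → Label
    σ s = proj₁ (image s)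

    σ-arc : ∀ s t → Arc G S (elt s) (elt t) → Permitted (σ s) (σ t)
    σ-arc s t st with S-labelled (preserves-arcs st)
    ... | r , e = permitted (σ s) (σ t) r
                    (trans (sym (cong₂ (λ u v → u ∙ v ⁻¹) (proj₂ (image t)) (proj₂ (image s)))) e)

    σb≢σy : σ B ≢ σ Y
    σb≢σy σb≡σy = b≢y (injective (trans (proj₂ (image B)) (trans (cong elt σb≡σy) (sym (proj₂ (image Y))))))

    σ-pinned : σ A ≡ A × σ B ≡ B × σ C ≡ C
    σ-pinned = pinned (σ-arc A B arc-ab) (σ-arc B C arc-bc) (σ-arc Y C arc-yc) σb≢σy

    fixed : ∀ s → σ s ≡ s → apply (elt s) ≡ elt s
    fixed s σs≡s = trans (proj₂ (image s)) (cong elt σs≡s)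

    fixes : ∀ {s} → s ∈ₗ a ∷ b ∷ c ∷ [] → apply s ≡ s
    fixes (here refl)                 = fixed A (proj₁ σ-pinned)
    fixes (there (here refl))         = fixed B (proj₁ (proj₂ σ-pinned))
    fixes (there (there (here refl))) = fixed C (proj₂ (proj₂ σ-pinned))

  finite : ∀ {s} → s ∈ₗ a ∷ b ∷ c ∷ [] → ∃ λ m → pow G s (suc m) ≡ ε
  finite (here refl)                 = order⇒finite order-a
  finite (there (here refl))         = order⇒finite order-b
  finite (there (there (here refl))) = order⇒finite order-c

  S-isORR : IsORR G S
  S-isORR = S-asymmetric
          , automorphism-isTranslation generates finite Fixing.fixes
          , translation-isAut

open FinGroup

lemma4p7 : (n : ℕ) (G : FinGroup n) (a b c : Fin n) →
    RankIs G 3 →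
    Generates G (a ∷ b ∷ c ∷ []) →
    OrderGt2 G a → OrderGt2 G b → OrderGt2 G c →
    OrderGt2 G (_∙_ G b (_⁻¹ G a)) → OrderGt2 G (_∙_ G c (_⁻¹ G b)) →
    comm G a b ≢ ε G →
    comm G b c ≡ ε G →
    AdmitsORR G
lemma4p7 n G a b c rank generates oa ob oc ox oy [a,b]≢1 [b,c]≡1 = S , S-isORR
  where open Setting G a b c rank generates oa ob oc ox oy [a,b]≢1 [b,c]≡1
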